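{- Let $G$ be a graph, $v\in V(G)$ and $W\subseteq V(G)\setminus\{v\}$. If $G[W]$ is a complete graph, then ${\rm ext}_G(v,W)=d_G(v,W)+1$.
   Context: All graphs are finite and simple. An orientation of a set of edges $S$ is an orientation of the graph formed by these edges. An orientation is $K^\circlearrowright_3$-free if it contains no cyclically oriented triangle. For a graph $G$, $\mathcal{D}(G)$ denotes the set of $K^\circlearrowright_3$-free orientations of $G$. Orientations $\vec S,\vec T$ of disjoint edge sets $S,T\subseteq E(G)$ are compatible if the combined orientation $\vec S\cup\vec T$ of $S\cup T$ is $K^\circlearrowright_3$-free. For disjoint $A,B\subseteq V(G)$, $G[A,B]$ denotes the graph with the edges of $G$ between $A$ and $B$, and with $T=G[A]\cup G[B]$, ${\rm ext}_G(A,B)=\max_{\vec T\in\mathcal{D}(T)}|\{\vec S\in\mathcal{D}(G[A,B])\colon \vec S\text{ and }\vec T\text{ are compatible}\}|$. We write ${\rm ext}_G(v,W)$ for ${\rm ext}_G(\{v\},W)$. $d_G(v,W)$ is the number of neighbours of $v$ in $W$. -}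

module Defs where

open import Data.Bool using (Bool; true; false; _∧_; _∨_; not; _xor_; if_then_else_; T)
open import Data.Nat using (ℕ; zero; suc; _⊔_)
open import Data.Fin using (Fin)
open import Data.Fin.Subset using (Subset; _∈_; ⁅_⁆)
open import Data.Vec using (Vec; []; _∷_; lookup; zipWith)
open import Data.List using (List; []; _∷_; [_]; map; concatMap; filterᵇ; length; allFin; foldr)
open import Data.Bool.ListAction using (all; any)
open import Relation.Binary.PropositionalEquality using (_≡_; _≢_)

record Graph (n : ℕ) : Set where
  field
    adj    : Fin n → Fin n → Bool
    sym    : ∀ u v → adj u v ≡ adj v u
    irrefl : ∀ u → adj u u ≡ false
open Graph public

mem : ∀ {n} → Subset n → Fin n → Bool
mem A u = lookup A u

-- An edge set of a graph on Fin n, given by its (symmetric) indicator.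
EdgeSet : ℕ → Set
EdgeSet n = Fin n → Fin n → Bool

cross : ∀ {n} → Graph n → Subset n → Subset n → EdgeSet n
cross G A B u v = adj G u v ∧ ((mem A u ∧ mem B v) ∨ (mem B u ∧ mem A v))

inside : ∀ {n} → Graph n → Subset n → Subset n → EdgeSet n
inside G A B u v = adj G u v ∧ ((mem A u ∧ mem A v) ∨ (mem B u ∧ mem B v))

-- Orientations. An oriented edge set is an n×n Boolean matrix o,
-- o[u][v] = true meaning the arc u → v is present.

Orient : ℕ → Set
Orient n = Vec (Vec Bool n) n

arc : ∀ {n} → Orient n → Fin n → Fin n → Bool
arc o u v = lookup (lookup o u) v

allFinᵇ : ∀ {n} → (Fin n → Bool) → Bool
allFinᵇ {n} p = all p (allFin n)

anyFinᵇ : ∀ {n} → (Fin n → Bool) → Bool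
anyFinᵇ {n} p = any p (allFin n)

isOrientationOf : ∀ {n} → EdgeSet n → Orient n → Bool
isOrientationOf S o =
  allFinᵇ λ u → allFinᵇ λ v →
    if S u v then arc o u v xor arc o v u else not (arc o u v)

hasCyclicTriangle : ∀ {n} → Orient n → Bool
hasCyclicTriangle o =
  anyFinᵇ λ a → anyFinᵇ λ b → anyFinᵇ λ c →
    arc o a b ∧ arc o b c ∧ arc o c a

K3free : ∀ {n} → Orient n → Bool
K3free o = not (hasCyclicTriangle o)

_∪ₒ_ : ∀ {n} → Orient n → Orient n → Orient n
o₁ ∪ₒ o₂ = zipWith (zipWith _∨_) o₁ o₂

compatible : ∀ {n} → Orient n → Orient n → Bool
compatible o₁ o₂ = K3free (o₁ ∪ₒ o₂)

vecsOver : ∀ {A : Set} → List A → (m : ℕ) → List (Vec A m)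
vecsOver xs zero    = [ [] ]
vecsOver xs (suc m) = concatMap (λ x → map (x ∷_) (vecsOver xs m)) xs

allOrients : (n : ℕ) → List (Orient n)
allOrients n = vecsOver (vecsOver (true ∷ false ∷ []) n) n

𝒟 : ∀ {n} → EdgeSet n → List (Orient n)
𝒟 {n} S = filterᵇ (λ o → isOrientationOf S o ∧ K3free o) (allOrients n)

maxList : List ℕ → ℕ
maxList = foldr _⊔_ 0

ext : ∀ {n} → Graph n → Subset n → Subset n → ℕ
ext G A B =
  maxList (map (λ t → length (filterᵇ (λ s → compatible s t) (𝒟 (cross G A B))))
               (𝒟 (inside G A B)))

deg : ∀ {n} → Graph n → Fin n → Subset n → ℕ
deg {n} G v W = length (filterᵇ (λ u → adj G v u ∧ mem W u) (allFin n))

IsCompleteOn : ∀ {n} → Graph n → Subset n → Set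
IsCompleteOn G W = ∀ u w → u ∈ W → w ∈ W → u ≢ w → adj G u w ≡ true

module Submission where

-- Write S for the edges of G[{v},W] (a star from v to its neighbours N in W)
-- and T = G[{v}] ∪ G[W] = G[W].  Fix a K3-free orientation t of T.  Because
-- G[W] is complete, t is a strict linear order on W.  An orientation of S is
-- determined by the set D of neighbours pointing towards v, and it is
-- compatible with t iff D is closed under t-predecessors: the only possible
-- cyclic triangles are v → b → c → v with b → c an arc of t.  For a linear
-- order these closed sets are all of N ("top") and, for each neighbour x, the
-- neighbours strictly before x ("prefix x"); they are pairwise distinct, so
-- exactly d_G(v,W) + 1 orientations of S are compatible with every t.  Since
-- T has a K3-free orientation (orient by vertex index), the maximum is d + 1.

open import Defs
open import Data.Nat using (ℕ; _+_)
open import Data.Fin using (Fin)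
open import Data.Fin.Subset using (Subset; _∉_; ⁅_⁆)
open import Relation.Binary.PropositionalEquality using (_≡_)

open import Data.Bool using (Bool; true; false; _∧_; _∨_; not; _xor_; if_then_else_)
import Data.Bool.Properties as Bool
open import Data.Bool.ListAction using (all; any)
open import Data.Nat using (zero; suc; _*_; _⊔_)
import Data.Nat.Properties as ℕ
open import Data.List using (List; []; _∷_; map; concatMap; filterᵇ; length; allFin; _++_)
open import Data.List.Membership.Propositional using (_∈_)
open import Data.List.Relation.Unary.Any using (here; there)
import Data.List.Relation.Unary.All as All
open import Data.List.Relation.Unary.Unique.Propositional using (Unique)
open import Data.List.Relation.Unary.AllPairs using (_∷_)
open import Data.Vec using (Vec; []; _∷_; lookup; tabulate; zipWith)
import Data.Vec.Properties as Vec
open import Data.Product using (∃-syntax; _×_; _,_; proj₁; proj₂)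
open import Data.Sum using (_⊎_; inj₁; inj₂; [_,_])
open import Data.Empty using (⊥; ⊥-elim)
open import Data.Fin using (_<_) renaming (_≟_ to _≟ᶠ_)
import Data.Fin.Properties as Fin
import Data.Fin.Subset.Properties as SubsetP
open import Data.List.Membership.Propositional.Properties using (∈-allFin; ∈-filter⁺; ∈-filter⁻)
open import Data.List.Relation.Unary.Unique.Propositional.Properties using (allFin⁺)
open import Function.Bundles using (Equivalence; mk⇔)
open import Relation.Nullary using (Dec; yes; no; ¬_)
open import Relation.Nullary.Decidable using (does; dec-true; dec-false)
open import Relation.Binary.Definitions using (DecidableEquality; tri<; tri≈; tri>)
open import Relation.Binary.PropositionalEquality as ≡ using (_≢_; refl; cong; cong₂; trans; module ≡-Reasoning)

∧-true : ∀ {a b} → a ∧ b ≡ true → a ≡ true × b ≡ true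
∧-true {true} {true} _ = refl , refl

∨-true : ∀ {a b} → a ∨ b ≡ true → a ≡ true ⊎ b ≡ true
∨-true {true}  _ = inj₁ refl
∨-true {false} e = inj₂ e

true≢false : true ≢ false
true≢false ()

does-true : ∀ {P : Set} (d : Dec P) → does d ≡ true → P
does-true (yes p) _ = p

count : ∀ {A : Set} → (A → Bool) → List A → ℕ
count p xs = length (filterᵇ p xs)

count-map : ∀ {A B : Set} (p : B → Bool) (f : A → B) xs → count p (map f xs) ≡ count (λ x → p (f x)) xs
count-map p f []       = refl
count-map p f (x ∷ xs) with p (f x)
... | true  = cong suc (count-map p f xs)
... | false = count-map p f xs

module _ {A : Set} where

  count-cons : (p : A → Bool) (x : A) (xs : List A) →
    count p (x ∷ xs) ≡ (if p x then 1 else 0) + count p xs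
  count-cons p x xs with p x
  ... | true  = refl
  ... | false = refl

  count-none : (xs : List A) → count (λ _ → false) xs ≡ 0
  count-none []       = refl
  count-none (_ ∷ xs) = count-none xs

  count-cong : (p q : A → Bool) (xs : List A) → (∀ x → p x ≡ q x) → count p xs ≡ count q xs
  count-cong p q []       p≗q = refl
  count-cong p q (x ∷ xs) p≗q rewrite count-cons p x xs | count-cons q x xs | p≗q x =
    cong (_ +_) (count-cong p q xs p≗q)

  count-∨ : (p q : A → Bool) (xs : List A) → (∀ x → p x ∧ q x ≡ false) →
    count (λ x → p x ∨ q x) xs ≡ count p xs + count q xs
  count-∨ p q []       disj = refl
  count-∨ p q (x ∷ xs) disj with p x | q x | disj x
  ... | false | false | _ = count-∨ p q xs disj
  ... | false | true  | _ = trans (cong suc (count-∨ p q xs disj)) (≡.sym (ℕ.+-suc _ _))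
  ... | true  | false | _ = cong suc (count-∨ p q xs disj)

  count-++ : (p : A → Bool) (xs ys : List A) → count p (xs ++ ys) ≡ count p xs + count p ys
  count-++ p []       ys = refl
  count-++ p (x ∷ xs) ys with p x
  ... | true  = cong suc (count-++ p xs ys)
  ... | false = count-++ p xs ys

  filter-filter : (p q : A → Bool) (xs : List A) →
    filterᵇ q (filterᵇ p xs) ≡ filterᵇ (λ x → p x ∧ q x) xs
  filter-filter p q []       = refl
  filter-filter p q (x ∷ xs) with p x
  ... | false = filter-filter p q xs
  ... | true with q x
  ... | false = filter-filter p q xs
  ... | true  = cong (x ∷_) (filter-filter p q xs)

  any-witness : (p : A → Bool) (xs : List A) → any p xs ≡ true → ∃[ x ] (x ∈ xs × p x ≡ true)
  any-witness p (x ∷ xs) e with p x in px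
  ... | true  = x , here refl , px
  ... | false with any-witness p xs e
  ... | y , y∈xs , py = y , there y∈xs , py

  any-intro : (p : A → Bool) {xs : List A} {x : A} → x ∈ xs → p x ≡ true → any p xs ≡ true
  any-intro p {y ∷ xs} (here refl) px rewrite px = refl
  any-intro p {y ∷ xs} (there x∈xs) px with p y
  ... | true  = refl
  ... | false = any-intro p x∈xs px

  any-none : (p : A → Bool) (xs : List A) → (∀ x → p x ≡ false) → any p xs ≡ false
  any-none p []       none = refl
  any-none p (x ∷ xs) none rewrite none x = any-none p xs none

  all-elim : (p : A → Bool) {xs : List A} → all p xs ≡ true → ∀ {x} → x ∈ xs → p x ≡ true
  all-elim p {y ∷ xs} e x∈ with p y in py
  all-elim p {y ∷ xs} e (here refl) | true = py
  all-elim p {y ∷ xs} e (there x∈)  | true = all-elim p e x∈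

  all-intro : (p : A → Bool) (xs : List A) → (∀ x → p x ≡ true) → all p xs ≡ true
  all-intro p []       every = refl
  all-intro p (x ∷ xs) every rewrite every x = all-intro p xs every

  maxList-constant : (g : A → ℕ) {c : ℕ} {x₀ : A} (xs : List A) → x₀ ∈ xs →
    (∀ {x} → x ∈ xs → g x ≡ c) → maxList (map g xs) ≡ c
  maxList-constant g (x ∷ [])     _ g≡c = trans (ℕ.⊔-identityʳ (g x)) (g≡c (here refl))
  maxList-constant g {c} (x ∷ y ∷ xs) _ g≡c = begin
    g x ⊔ maxList (map g (y ∷ xs)) ≡⟨ cong₂ _⊔_ (g≡c (here refl))
                                         (maxList-constant g (y ∷ xs) (here refl) (λ x∈ → g≡c (there x∈))) ⟩
    c ⊔ c                          ≡⟨ ℕ.⊔-idem c ⟩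
    c                              ∎
    where open ≡-Reasoning

module Enumeration {A : Set} (_≟_ : DecidableEquality A) where

  occurrences : List A → A → ℕ
  occurrences xs a = count (λ y → does (y ≟ a)) xs

  Enumerates : List A → Set
  Enumerates xs = ∀ a → occurrences xs a ≡ 1

  occurs⇒∈ : ∀ xs {a} → occurrences xs a ≡ 1 → a ∈ xs
  occurs⇒∈ (y ∷ xs) {a} once with y ≟ a
  ... | yes refl = here refl
  ... | no _     = there (occurs⇒∈ xs once)

  count-image : ∀ L → Enumerates L → {B : Set} (f : B → A) (Q : B → Bool) →
    (∀ {x y} → Q x ≡ true → Q y ≡ true → f x ≡ f y → x ≡ y) →
    (xs : List B) → Unique xs →
    count (λ a → any (λ x → Q x ∧ does (a ≟ f x)) xs) L ≡ count Q xs
  count-image L enum f Q f-inj []       _           = count-none L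
  count-image L enum f Q f-inj (x ∷ xs) (x∉ ∷ uniq) = begin
    count (λ a → hitsX a ∨ hitsXs a) L           ≡⟨ count-∨ hitsX hitsXs L disjoint ⟩
    count hitsX L + count hitsXs L               ≡⟨ cong₂ _+_ (singleton (Q x))
                                                              (count-image L enum f Q f-inj xs uniq) ⟩
    (if Q x then 1 else 0) + count Q xs          ≡⟨ ≡.sym (count-cons Q x xs) ⟩
    count Q (x ∷ xs)                             ∎
    where
      open ≡-Reasoning
      hitsX hitsXs : A → Bool
      hitsX a  = Q x ∧ does (a ≟ f x)
      hitsXs a = any (λ y → Q y ∧ does (a ≟ f y)) xs

      singleton : ∀ b → count (λ a → b ∧ does (a ≟ f x)) L ≡ (if b then 1 else 0)
      singleton true  = enum (f x)
      singleton false = count-none L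

      disjoint : ∀ a → hitsX a ∧ hitsXs a ≡ false
      disjoint a with hitsX a in hx | hitsXs a in hxs
      ... | false | _     = refl
      ... | true  | false = refl
      ... | true  | true with any-witness (λ y → Q y ∧ does (a ≟ f y)) xs hxs
      ... | y , y∈xs , hy with ∧-true hx | ∧-true hy
      ... | Qx , a≡fx | Qy , a≡fy = ⊥-elim (All.lookup x∉ y∈xs
              (f-inj Qx Qy (trans (≡.sym (does-true (a ≟ f x) a≡fx)) (does-true (a ≟ f y) a≡fy))))

module VecEnumeration {A : Set} (_≟_ : DecidableEquality A) where
  open Enumeration using (occurrences; Enumerates)

  _≟ᵥ_ : ∀ {m} → DecidableEquality (Vec A m)
  _≟ᵥ_ = Vec.≡-dec _≟_

  occurrences-prefixed : ∀ {m} x a (w : Vec A m) V →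
    occurrences _≟ᵥ_ (map (x ∷_) V) (a ∷ w) ≡ (if does (x ≟ a) then occurrences _≟ᵥ_ V w else 0)
  occurrences-prefixed x a w V = trans (count-map _ (x ∷_) V) (by-head (does (x ≟ a)))
    where
      by-head : ∀ b → count (λ u → b ∧ does (u ≟ᵥ w)) V ≡ (if b then occurrences _≟ᵥ_ V w else 0)
      by-head true  = refl
      by-head false = count-none V

  occurrences-concat : ∀ {m} xs a (w : Vec A m) V →
    occurrences _≟ᵥ_ (concatMap (λ x → map (x ∷_) V) xs) (a ∷ w)
      ≡ occurrences _≟_ xs a * occurrences _≟ᵥ_ V w
  occurrences-concat []       a w V = refl
  occurrences-concat (x ∷ xs) a w V
    rewrite count-++ (λ u → does (u ≟ᵥ (a ∷ w))) (map (x ∷_) V) (concatMap (λ x → map (x ∷_) V) xs)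
          | occurrences-prefixed x a w V | occurrences-concat xs a w V
    with does (x ≟ a)
  ... | true  = refl
  ... | false = refl

  vecsOver-enumerates : ∀ {xs} → Enumerates _≟_ xs → ∀ m → Enumerates _≟ᵥ_ (vecsOver xs m)
  vecsOver-enumerates enum zero    []      = refl
  vecsOver-enumerates {xs} enum (suc m) (a ∷ w) = begin
    occurrences _≟ᵥ_ (vecsOver xs (suc m)) (a ∷ w)
      ≡⟨ occurrences-concat xs a w (vecsOver xs m) ⟩
    occurrences _≟_ xs a * occurrences _≟ᵥ_ (vecsOver xs m) w
      ≡⟨ cong₂ _*_ (enum a) (vecsOver-enumerates enum m w) ⟩
    1 ∎
    where open ≡-Reasoning

lookup-ext : ∀ {A : Set} {m} {xs ys : Vec A m} → (∀ i → lookup xs i ≡ lookup ys i) → xs ≡ ys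
lookup-ext {xs = xs} {ys} same = begin
  xs                   ≡⟨ ≡.sym (Vec.tabulate∘lookup xs) ⟩
  tabulate (lookup xs) ≡⟨ Vec.tabulate-cong same ⟩
  tabulate (lookup ys) ≡⟨ Vec.tabulate∘lookup ys ⟩
  ys                   ∎
  where open ≡-Reasoning

module _ {n : ℕ} where

  arc-ext : {o o′ : Orient n} → (∀ a b → arc o a b ≡ arc o′ a b) → o ≡ o′
  arc-ext same = lookup-ext (λ a → lookup-ext (same a))

  fromArcs : (Fin n → Fin n → Bool) → Orient n
  fromArcs f = tabulate (λ a → tabulate (f a))

  arc-fromArcs : ∀ f a b → arc (fromArcs f) a b ≡ f a b
  arc-fromArcs f a b rewrite Vec.lookup∘tabulate (λ a → tabulate (f a)) a = Vec.lookup∘tabulate (f a) b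

  arc-∪ : ∀ (o₁ o₂ : Orient n) a b → arc (o₁ ∪ₒ o₂) a b ≡ arc o₁ a b ∨ arc o₂ a b
  arc-∪ o₁ o₂ a b rewrite Vec.lookup-zipWith (zipWith _∨_) a o₁ o₂ =
    Vec.lookup-zipWith _∨_ b (lookup o₁ a) (lookup o₂ a)

  arc-∪-split : ∀ (o₁ o₂ : Orient n) {a b} → arc (o₁ ∪ₒ o₂) a b ≡ true →
    arc o₁ a b ≡ true ⊎ arc o₂ a b ≡ true
  arc-∪-split o₁ o₂ {a} {b} e = ∨-true (trans (≡.sym (arc-∪ o₁ o₂ a b)) e)

  arc-∪ˡ : ∀ (o₁ o₂ : Orient n) {a b} → arc o₁ a b ≡ true → arc (o₁ ∪ₒ o₂) a b ≡ true
  arc-∪ˡ o₁ o₂ {a} {b} e rewrite arc-∪ o₁ o₂ a b | e = refl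

  arc-∪ʳ : ∀ (o₁ o₂ : Orient n) {a b} → arc o₂ a b ≡ true → arc (o₁ ∪ₒ o₂) a b ≡ true
  arc-∪ʳ o₁ o₂ {a} {b} e rewrite arc-∪ o₁ o₂ a b | e = Bool.∨-zeroʳ _

  OrientsAt : EdgeSet n → Orient n → Fin n → Fin n → Bool
  OrientsAt S o a b = if S a b then arc o a b xor arc o b a else not (arc o a b)

  OrientsAt-outside : (S : EdgeSet n) (o : Orient n) {a b : Fin n} →
    S a b ≡ false → arc o a b ≡ false → OrientsAt S o a b ≡ true
  OrientsAt-outside S o s ab rewrite s | ab = refl

  orientation-intro : (S : EdgeSet n) (o : Orient n) → (∀ a b → OrientsAt S o a b ≡ true) →
    isOrientationOf S o ≡ true
  orientation-intro S o h = all-intro _ (allFin n) (λ a → all-intro _ (allFin n) (h a))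

  CyclicTriangle : Orient n → Set
  CyclicTriangle o = ∃[ a ] ∃[ b ] ∃[ c ] (arc o a b ≡ true × arc o b c ≡ true × arc o c a ≡ true)

  K3free⇒noCycle : (o : Orient n) → K3free o ≡ true → ¬ CyclicTriangle o
  K3free⇒noCycle o free (a , b , c , ab , bc , ca) = true≢false (trans (≡.sym free) (cong not cyclic))
    where
      cyclic : hasCyclicTriangle o ≡ true
      cyclic = any-intro _ (∈-allFin a) (any-intro _ (∈-allFin b) (any-intro _ (∈-allFin c) abc))
        where abc : arc o a b ∧ arc o b c ∧ arc o c a ≡ true
              abc rewrite ab | bc | ca = refl

  noCycle⇒K3free : (o : Orient n) → ¬ CyclicTriangle o → K3free o ≡ true
  noCycle⇒K3free o acyclic = cong not (any-none _ (allFin n) λ a → any-none _ (allFin n) λ b →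
                                          any-none _ (allFin n) λ c → notCyclic a b c)
    where
      notCyclic : ∀ a b c → arc o a b ∧ arc o b c ∧ arc o c a ≡ false
      notCyclic a b c with arc o a b in ab | arc o b c in bc | arc o c a in ca
      ... | false | _     | _     = refl
      ... | true  | false | _     = refl
      ... | true  | true  | false = refl
      ... | true  | true  | true  = ⊥-elim (acyclic (a , b , c , ab , bc , ca))

module Orientation {n : ℕ} (S : EdgeSet n) (o : Orient n) (orients : isOrientationOf S o ≡ true) where

  orients-at : ∀ a b → OrientsAt S o a b ≡ true
  orients-at a b = all-elim _ (all-elim _ orients (∈-allFin a)) (∈-allFin b)

  arc⇒edge : ∀ {a b} → arc o a b ≡ true → S a b ≡ true
  arc⇒edge {a} {b} ab with S a b | orients-at a b
  ... | true  | _ = refl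
  ... | false | h rewrite ab = ⊥-elim (true≢false (≡.sym h))

  arc-outside : ∀ {a b} → S a b ≡ false → arc o a b ≡ false
  arc-outside {a} {b} s with S a b | orients-at a b
  ... | false | h = Bool.not-injective h

  arc-flip : ∀ {a b} → S a b ≡ true → arc o a b ≡ not (arc o b a)
  arc-flip {a} {b} s with S a b | orients-at a b
  ... | true | h = xor-true (arc o a b) (arc o b a) h
    where xor-true : ∀ x y → x xor y ≡ true → x ≡ not y
          xor-true true  y e = ≡.sym e
          xor-true false true  _ = refl
          xor-true false false ()

  arc-reverse : ∀ {a b} → S a b ≡ true → arc o a b ≡ false → arc o b a ≡ true
  arc-reverse s ab = Bool.not-injective (trans (≡.sym (arc-flip s)) ab)

  arc-asym : ∀ {a b} → arc o a b ≡ true → arc o b a ≡ false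
  arc-asym ab = Bool.not-injective (trans (≡.sym (arc-flip (arc⇒edge ab))) ab)

  arc-irrefl : ∀ a → arc o a a ≡ false
  arc-irrefl a with arc o a a in aa
  ... | false = refl
  ... | true  = trans (≡.sym aa) (arc-asym aa)

module ByIndex {n : ℕ} (S : EdgeSet n) (S-sym : ∀ a b → S a b ≡ S b a) (S-loopless : ∀ a → S a a ≡ false) where

  byIndex : Orient n
  byIndex = fromArcs (λ a b → S a b ∧ does (a Fin.<? b))

  byIndex-orients : isOrientationOf S byIndex ≡ true
  byIndex-orients = orientation-intro S byIndex at
    where
      at : ∀ a b → OrientsAt S byIndex a b ≡ true
      at a b rewrite arc-fromArcs (λ a b → S a b ∧ does (a Fin.<? b)) a b
                   | arc-fromArcs (λ a b → S a b ∧ does (a Fin.<? b)) b a | S-sym b a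
        with S a b in ab | Fin.<-cmp a b
      ... | false | _ = refl
      ... | true | tri< a<b _ b≮a rewrite dec-true (a Fin.<? b) a<b | dec-false (b Fin.<? a) b≮a = refl
      ... | true | tri> a≮b _ b<a rewrite dec-true (b Fin.<? a) b<a | dec-false (a Fin.<? b) a≮b = refl
      ... | true | tri≈ _ refl _ = ⊥-elim (true≢false (trans (≡.sym ab) (S-loopless a)))

  arc-increases : ∀ {a b} → arc byIndex a b ≡ true → a < b
  arc-increases {a} {b} e = does-true (a Fin.<? b)
    (proj₂ (∧-true (trans (≡.sym (arc-fromArcs (λ a b → S a b ∧ does (a Fin.<? b)) a b)) e)))

  byIndex-K3free : K3free byIndex ≡ true
  byIndex-K3free = noCycle⇒K3free byIndex λ (a , b , c , ab , bc , ca) →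
    Fin.<-irrefl refl (Fin.<-trans (arc-increases ab) (Fin.<-trans (arc-increases bc) (arc-increases ca)))

module Least {A : Set} (_≟_ : DecidableEquality A) (R : A → A → Bool) (Q : A → Bool)
  (R-trans : ∀ {x y z} → R x y ≡ true → R y z ≡ true → R x z ≡ true)
  (R-total : ∀ {x y} → Q x ≡ true → Q y ≡ true → x ≢ y → R x y ≡ true ⊎ R y x ≡ true) where

  LeastIn : List A → A → Set
  LeastIn xs x = Q x ≡ true × (∀ {z} → z ∈ xs → Q z ≡ true → z ≡ x ⊎ R x z ≡ true)

  least-or-none : ∀ xs → (∀ {z} → z ∈ xs → Q z ≡ false) ⊎ ∃[ x ] LeastIn xs x
  least-or-none [] = inj₁ λ ()
  least-or-none (y ∷ ys) with Q y in qy | least-or-none ys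
  ... | false | inj₁ none = inj₁ λ { (here refl) → qy ; (there z∈) → none z∈ }
  ... | false | inj₂ (x , qx , below) = inj₂ (x , qx , λ
        { (here refl) qz → ⊥-elim (true≢false (trans (≡.sym qz) qy)) ; (there z∈) → below z∈ })
  ... | true | inj₁ none = inj₂ (y , qy , λ
        { (here refl) _ → inj₁ refl ; (there z∈) qz → ⊥-elim (true≢false (trans (≡.sym qz) (none z∈))) })
  ... | true | inj₂ (x , qx , below) with y ≟ x
  ...   | yes refl = inj₂ (x , qx , λ { (here refl) _ → inj₁ refl ; (there z∈) → below z∈ })
  ...   | no y≢x with R-total qy qx y≢x
  ...     | inj₂ Rxy = inj₂ (x , qx , λ { (here refl) _ → inj₂ Rxy ; (there z∈) → below z∈ })
  ...     | inj₁ Ryx = inj₂ (y , qy , λ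
          { (here refl) _ → inj₁ refl
          ; (there z∈) qz → inj₂ ([ (λ { refl → Ryx }) , R-trans Ryx ] (below z∈ qz)) })

_≟ₒ_ : ∀ {n} → DecidableEquality (Orient n)
_≟ₒ_ = Vec.≡-dec (Vec.≡-dec Bool._≟_)

allOrients-enumerates : ∀ n → Enumeration.Enumerates _≟ₒ_ (allOrients n)
allOrients-enumerates n =
  VecEnumeration.vecsOver-enumerates (Vec.≡-dec Bool._≟_) (VecEnumeration.vecsOver-enumerates Bool._≟_ bools n) n
  where bools : Enumeration.Enumerates Bool._≟_ (true ∷ false ∷ [])
        bools true  = refl
        bools false = refl

module _ {n : ℕ} {S : EdgeSet n} {o : Orient n} where

  ∈-𝒟⁻ : o ∈ 𝒟 S → isOrientationOf S o ≡ true × K3free o ≡ true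
  ∈-𝒟⁻ o∈ = ∧-true (Equivalence.to Bool.T-≡
    (proj₂ (∈-filter⁻ (λ o → Bool.T? (isOrientationOf S o ∧ K3free o)) {xs = allOrients n} o∈)))

  ∈-𝒟⁺ : isOrientationOf S o ≡ true → K3free o ≡ true → o ∈ 𝒟 S
  ∈-𝒟⁺ orients free = ∈-filter⁺ (λ o → Bool.T? (isOrientationOf S o ∧ K3free o))
    (Enumeration.occurs⇒∈ _≟ₒ_ (allOrients n) (allOrients-enumerates n o))
    (Equivalence.from Bool.T-≡ (cong₂ _∧_ orients free))

mem-singleton : ∀ {n} (v u : Fin n) → mem ⁅ v ⁆ u ≡ does (u ≟ᶠ v)
mem-singleton v u with u ≟ᶠ v
... | yes refl = Vec.[]=⇒lookup (SubsetP.x∈⁅x⁆ v)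
... | no u≢v with mem ⁅ v ⁆ u in e
...   | false = refl
...   | true  = ⊥-elim (u≢v (SubsetP.x∈⁅y⁆⇒x≡y v (Vec.lookup⇒[]= u ⁅ v ⁆ e)))

module Star {n : ℕ} (G : Graph n) (v : Fin n) (W : Subset n) (v∉W : v ∉ W) where

  S T : EdgeSet n
  S = cross G ⁅ v ⁆ W
  T = inside G ⁅ v ⁆ W

  isv : Fin n → Bool
  isv u = does (u ≟ᶠ v)

  isv-v : isv v ≡ true
  isv-v = dec-true (v ≟ᶠ v) refl

  isv⇒≡ : ∀ {u} → isv u ≡ true → u ≡ v
  isv⇒≡ {u} = does-true (u ≟ᶠ v)

  v∉Wᵇ : mem W v ≡ false
  v∉Wᵇ with mem W v in e
  ... | false = refl
  ... | true  = ⊥-elim (v∉W (Vec.lookup⇒[]= v W e))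

  W⇒≢v : ∀ {u} → mem W u ≡ true → isv u ≡ false
  W⇒≢v {u} u∈W with u ≟ᶠ v
  ... | no _     = refl
  ... | yes refl = ⊥-elim (true≢false (trans (≡.sym u∈W) v∉Wᵇ))

  -- the neighbours of v in W; note that deg G v W = count N (allFin n)
  N : Fin n → Bool
  N u = adj G v u ∧ mem W u

  N⇒W : ∀ {u} → N u ≡ true → mem W u ≡ true
  N⇒W Nu = proj₂ (∧-true Nu)

  N⇒≢v : ∀ {u} → N u ≡ true → isv u ≡ false
  N⇒≢v Nu = W⇒≢v (N⇒W Nu)

  N-v : N v ≡ false
  N-v rewrite Graph.irrefl G v = refl

  S-at : ∀ a b → S a b ≡ adj G a b ∧ ((isv a ∧ mem W b) ∨ (mem W a ∧ isv b))
  S-at a b rewrite mem-singleton v a | mem-singleton v b = refl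

  T-at : ∀ a b → T a b ≡ adj G a b ∧ ((isv a ∧ isv b) ∨ (mem W a ∧ mem W b))
  T-at a b rewrite mem-singleton v a | mem-singleton v b = refl

  S-from-v : ∀ y → S v y ≡ N y
  S-from-v y rewrite S-at v y | isv-v | v∉Wᵇ | Bool.∨-identityʳ (mem W y) = refl

  S-to-v : ∀ y → S y v ≡ N y
  S-to-v y rewrite S-at y v | isv-v | v∉Wᵇ | Bool.∧-zeroʳ (isv y) | Bool.∧-identityʳ (mem W y)
                 | Graph.sym G y v = refl

  S-away : ∀ {a b} → isv a ≡ false → isv b ≡ false → S a b ≡ false
  S-away {a} {b} a≢v b≢v rewrite S-at a b | a≢v | b≢v | Bool.∧-zeroʳ (mem W a) = Bool.∧-zeroʳ (adj G a b)

  T⇒W : ∀ {a b} → T a b ≡ true → mem W a ≡ true × mem W b ≡ true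
  T⇒W {a} {b} e with ∧-true (trans (≡.sym (T-at a b)) e)
  ... | ab , parts with ∨-true parts
  ...   | inj₂ inW = ∧-true inW
  ...   | inj₁ both-v with isv⇒≡ {a} (proj₁ (∧-true both-v)) | isv⇒≡ {b} (proj₂ (∧-true both-v))
  ...     | refl | refl = ⊥-elim (true≢false (trans (≡.sym ab) (Graph.irrefl G v)))

  T-sym : ∀ a b → T a b ≡ T b a
  T-sym a b rewrite T-at a b | T-at b a | Graph.sym G a b
                  | Bool.∧-comm (isv a) (isv b) | Bool.∧-comm (mem W a) (mem W b) = refl

  T-loopless : ∀ a → T a a ≡ false
  T-loopless a rewrite T-at a a | Graph.irrefl G a = refl

  -- the star orientation in which a neighbour y points towards v exactly when D y
  starArc : (Fin n → Bool) → Fin n → Fin n → Bool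
  starArc D a b = (isv a ∧ N b ∧ not (D b)) ∨ (N a ∧ D a ∧ isv b)

  star : (Fin n → Bool) → Orient n
  star D = fromArcs (starArc D)

  star-away : ∀ D {a b} → isv a ≡ false → isv b ≡ false → starArc D a b ≡ false
  star-away D {a} {b} a≢v b≢v rewrite a≢v | b≢v | Bool.∧-zeroʳ (D a) = Bool.∧-zeroʳ (N a)

  star-from-v : ∀ D b → arc (star D) v b ≡ N b ∧ not (D b)
  star-from-v D b rewrite arc-fromArcs (starArc D) v b | isv-v | N-v = Bool.∨-identityʳ (N b ∧ not (D b))

  star-to-v : ∀ D {a} → isv a ≡ false → arc (star D) a v ≡ N a ∧ D a
  star-to-v D {a} a≢v rewrite arc-fromArcs (starArc D) a v | a≢v | isv-v = cong (N a ∧_) (Bool.∧-identityʳ (D a))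

  star-out : ∀ D {b} → arc (star D) v b ≡ true → N b ≡ true × D b ≡ false
  star-out D {b} e with ∧-true (trans (≡.sym (star-from-v D b)) e)
  ... | Nb , notDb = Nb , Bool.not-injective notDb

  star-in : ∀ D {c} → N c ≡ true → arc (star D) c v ≡ D c
  star-in D {c} Nc = trans (star-to-v D (N⇒≢v Nc)) (cong (_∧ D c) Nc)

  star-orients : ∀ D → isOrientationOf S (star D) ≡ true
  star-orients D = orientation-intro S (star D) at
    where
      from-v : ∀ b → OrientsAt S (star D) v b ≡ true
      from-v b rewrite arc-fromArcs (starArc D) v b | arc-fromArcs (starArc D) b v | S-from-v b | isv-v | N-v
        with N b in Nb
      ... | false = refl
      ... | true rewrite N⇒≢v Nb | Bool.∨-identityʳ (not (D b)) with D b
      ...   | true  = refl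
      ...   | false = refl

      to-v : ∀ a → isv a ≡ false → OrientsAt S (star D) a v ≡ true
      to-v a a≢v rewrite arc-fromArcs (starArc D) a v | arc-fromArcs (starArc D) v a | S-to-v a | a≢v | isv-v | N-v
                       | Bool.∧-identityʳ (D a) with N a
      ... | false = refl
      ... | true with D a
      ...   | true  = refl
      ...   | false = refl

      away : ∀ {a b} → isv a ≡ false → isv b ≡ false → OrientsAt S (star D) a b ≡ true
      away {a} {b} a≢v b≢v =
        OrientsAt-outside S (star D) (S-away a≢v b≢v) (trans (arc-fromArcs (starArc D) a b) (star-away D a≢v b≢v))

      at : ∀ a b → OrientsAt S (star D) a b ≡ true
      at a b with isv a in ea | isv b in eb
      ... | false | false = away ea eb
      ... | false | true with isv⇒≡ {b} eb
      ...   | refl = to-v a ea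
      at a b | true | _ with isv⇒≡ {a} ea
      ...   | refl = from-v b

  module CrossOrientation (o : Orient n) (o-orients : isOrientationOf S o ≡ true) where
    open Orientation S o o-orients public

    arc-flips : ∀ {a b} → arc o a b ≡ true → isv b ≡ not (isv a)
    arc-flips {a} {b} ab with isv a in ea | isv b in eb
    ... | true  | false = refl
    ... | false | true  = refl
    ... | false | false = ⊥-elim (true≢false (trans (≡.sym (arc⇒edge ab)) (S-away ea eb)))
    ... | true  | true with isv⇒≡ {a} ea | isv⇒≡ {b} eb
    ...   | refl | refl = ⊥-elim (true≢false (trans (≡.sym ab) (arc-irrefl v)))

    -- a star has no triangles at all
    cross-K3free : K3free o ≡ true
    cross-K3free = noCycle⇒K3free o λ (a , b , c , ab , bc , ca) →
      three-flips (isv a) (trans (arc-flips ca) (cong not (trans (arc-flips bc) (cong not (arc-flips ab)))))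
      where three-flips : ∀ x → x ≢ not (not (not x))
            three-flips true  ()
            three-flips false ()

    determined : ∀ D → (∀ {y} → N y ≡ true → arc o y v ≡ D y) → o ≡ star D
    determined D agree = arc-ext same
      where
        from-v : ∀ b → arc o v b ≡ N b ∧ not (D b)
        from-v b with N b in Nb
        ... | false = arc-outside (trans (S-from-v b) Nb)
        ... | true  = trans (arc-flip (trans (S-from-v b) Nb)) (cong not (agree Nb))

        to-v : ∀ a → arc o a v ≡ N a ∧ D a
        to-v a with N a in Na
        ... | false = arc-outside (trans (S-to-v a) Na)
        ... | true  = agree Na

        same : ∀ a b → arc o a b ≡ arc (star D) a b
        same a b with isv a in ea | isv b in eb
        ... | false | false = trans (arc-outside (S-away ea eb))
                                    (≡.sym (trans (arc-fromArcs (starArc D) a b) (star-away D ea eb)))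
        ... | false | true with isv⇒≡ {b} eb
        ...   | refl = trans (to-v a) (≡.sym (star-to-v D ea))
        same a b | true | _ with isv⇒≡ {a} ea
        ...   | refl = trans (from-v b) (≡.sym (star-from-v D b))

  module Compatibility (t : Orient n) (t-orients : isOrientationOf T t ≡ true) (t-K3free : K3free t ≡ true) where
    module OT = Orientation T t t-orients

    t-avoids-v : ∀ {a b} → arc t a b ≡ true → isv a ≡ false × isv b ≡ false
    t-avoids-v ab with T⇒W (OT.arc⇒edge ab)
    ... | a∈W , b∈W = W⇒≢v a∈W , W⇒≢v b∈W

    DownClosed : (Fin n → Bool) → Set
    DownClosed D = ∀ {y z} → N y ≡ true → D z ≡ true → arc t y z ≡ true → D y ≡ true

    module WithCross (o : Orient n) (o-orients : isOrientationOf S o ≡ true) where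
      open CrossOrientation o o-orients

      cycle-through-v : ∀ {b c} →
        arc (o ∪ₒ t) v b ≡ true → arc (o ∪ₒ t) b c ≡ true → arc (o ∪ₒ t) c v ≡ true →
        arc o v b ≡ true × arc t b c ≡ true × arc o c v ≡ true
      cycle-through-v {b} {c} vb bc cv with arc-∪-split o t vb | arc-∪-split o t cv
      ... | inj₂ tvb | _ = ⊥-elim (true≢false (trans (≡.sym isv-v) (proj₁ (t-avoids-v tvb))))
      ... | _ | inj₂ tcv = ⊥-elim (true≢false (trans (≡.sym isv-v) (proj₂ (t-avoids-v tcv))))
      ... | inj₁ ovb | inj₁ ocv with arc-∪-split o t bc
      ...   | inj₂ tbc = ovb , tbc , ocv
      ...   | inj₁ obc with isv⇒≡ {c} (trans (arc-flips obc) (cong not (trans (arc-flips ovb) (cong not isv-v))))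
      ...     | refl = ⊥-elim (true≢false (trans (≡.sym obc) (arc-asym ovb)))

      compatible-intro : (∀ {b c} → arc o v b ≡ true → arc t b c ≡ true → arc o c v ≡ true → ⊥) →
        compatible o t ≡ true
      compatible-intro no-v-cycle = noCycle⇒K3free (o ∪ₒ t) noCycle
        where
          through-v : ∀ {a b c} → isv a ≡ true →
            arc (o ∪ₒ t) a b ≡ true → arc (o ∪ₒ t) b c ≡ true → arc (o ∪ₒ t) c a ≡ true → ⊥
          through-v {a} a≡v ab bc ca with isv⇒≡ {a} a≡v
          ... | refl with cycle-through-v ab bc ca
          ...   | ovb , tbc , ocv = no-v-cycle ovb tbc ocv

          in-t : ∀ {a b} → isv a ≡ false → isv b ≡ false → arc (o ∪ₒ t) a b ≡ true → arc t a b ≡ true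
          in-t a≢v b≢v ab with arc-∪-split o t ab
          ... | inj₂ tab = tab
          ... | inj₁ oab = ⊥-elim (true≢false (trans (≡.sym (trans (arc-flips oab) (cong not a≢v))) b≢v))

          noCycle : ¬ CyclicTriangle (o ∪ₒ t)
          noCycle (a , b , c , ab , bc , ca) with isv a in ea | isv b in eb | isv c in ec
          ... | true  | _     | _     = through-v ea ab bc ca
          ... | _     | true  | _     = through-v eb bc ca ab
          ... | _     | _     | true  = through-v ec ca ab bc
          ... | false | false | false = K3free⇒noCycle t t-K3free
                                          (a , b , c , in-t ea eb ab , in-t eb ec bc , in-t ec ea ca)

      compatible⇒downClosed : compatible o t ≡ true → DownClosed (λ y → arc o y v)
      compatible⇒downClosed compat {y} {z} Ny ozv tyz with arc o y v in oyv
      ... | true  = refl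
      ... | false = ⊥-elim (K3free⇒noCycle (o ∪ₒ t) compat (v , y , z , ovy , arc-∪ʳ o t tyz , arc-∪ˡ o t ozv))
        where ovy = arc-∪ˡ o t (arc-reverse (trans (S-to-v y) Ny) oyv)

    star-compatible : ∀ D → DownClosed D → compatible (star D) t ≡ true
    star-compatible D closed = compatible-intro λ {b} {c} vb bc cv →
      let Nb , notDb = star-out D vb
          Nc = trans (≡.sym (S-to-v c)) (arc⇒edge cv)
      in true≢false (trans (≡.sym (closed Nb (trans (≡.sym (star-in D Nc)) cv) bc)) notDb)
      where open WithCross (star D) (star-orients D)
            open CrossOrientation (star D) (star-orients D) using (arc⇒edge)

module CompleteStar {n : ℕ} (G : Graph n) (v : Fin n) (W : Subset n) (v∉W : v ∉ W)
  (complete : IsCompleteOn G W)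
  (t : Orient n) (t-orients : isOrientationOf (inside G ⁅ v ⁆ W) t ≡ true) (t-K3free : K3free t ≡ true) where
  open Star G v W v∉W
  open Compatibility t t-orients t-K3free

  -- t is a strict total order on W: any two distinct vertices of W span an edge of T
  T-in-W : ∀ {a b} → mem W a ≡ true → mem W b ≡ true → a ≢ b → T a b ≡ true
  T-in-W {a} {b} a∈W b∈W a≢b
    rewrite T-at a b | complete a b (Vec.lookup⇒[]= a W a∈W) (Vec.lookup⇒[]= b W b∈W) a≢b | a∈W | b∈W =
      Bool.∨-zeroʳ _

  t-total : ∀ {a b} → mem W a ≡ true → mem W b ≡ true → a ≢ b → arc t a b ≡ true ⊎ arc t b a ≡ true
  t-total {a} {b} a∈W b∈W a≢b with arc t a b in ab
  ... | true  = inj₁ refl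
  ... | false = inj₂ (OT.arc-reverse (T-in-W a∈W b∈W a≢b) ab)

  t-trans : ∀ {x y z} → arc t x y ≡ true → arc t y z ≡ true → arc t x z ≡ true
  t-trans {x} {y} {z} xy yz with t-total (proj₁ (T⇒W (OT.arc⇒edge xy))) (proj₂ (T⇒W (OT.arc⇒edge yz)))
                                          (λ { refl → true≢false (trans (≡.sym yz) (OT.arc-asym xy)) })
  ... | inj₁ xz = xz
  ... | inj₂ zx = ⊥-elim (K3free⇒noCycle t t-K3free (x , y , z , xy , yz , zx))

  top : Orient n
  top = star (λ _ → true)

  prefix : Fin n → Orient n
  prefix x = star (λ y → arc t y x)

  module ShapeOf (o : Orient n) (o-orients : isOrientationOf S o ≡ true) (compat : compatible o t ≡ true) where
    open CrossOrientation o o-orients using (determined)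
    open WithCross o o-orients using (compatible⇒downClosed)

    Out : Fin n → Bool
    Out y = N y ∧ not (arc o y v)

    Out-total : ∀ {x y} → Out x ≡ true → Out y ≡ true → x ≢ y → arc t x y ≡ true ⊎ arc t y x ≡ true
    Out-total Ox Oy = t-total (N⇒W (proj₁ (∧-true Ox))) (N⇒W (proj₁ (∧-true Oy)))

    open Least _≟ᶠ_ (λ a b → arc t a b) Out t-trans Out-total

    none-out⇒top : (∀ {y} → y ∈ allFin n → Out y ≡ false) → o ≡ top
    none-out⇒top none = determined (λ _ → true) λ {y} Ny → in-arc Ny (none (∈-allFin y))
      where in-arc : ∀ {y} → N y ≡ true → Out y ≡ false → arc o y v ≡ true
            in-arc Ny Oy rewrite Ny = Bool.not-injective Oy

    least-out⇒prefix : ∀ {x} → LeastIn (allFin n) x → o ≡ prefix x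
    least-out⇒prefix {x} (Ox , below) = determined (λ y → arc t y x) agree
      where
        Nx = proj₁ (∧-true Ox)
        x-out : arc o x v ≡ false
        x-out = Bool.not-injective (proj₂ (∧-true Ox))

        agree : ∀ {y} → N y ≡ true → arc o y v ≡ arc t y x
        agree {y} Ny with arc o y v in oyv
        ... | false with below (∈-allFin y) (cong₂ _∧_ Ny (cong not oyv))
        ...   | inj₁ refl = ≡.sym (OT.arc-irrefl x)
        ...   | inj₂ txy  = ≡.sym (OT.arc-asym txy)
        agree {y} Ny | true with y ≟ᶠ x
        ...   | yes refl = ⊥-elim (true≢false (trans (≡.sym oyv) x-out))
        ...   | no y≢x with t-total (N⇒W Ny) (N⇒W Nx) y≢x
        ...     | inj₁ tyx = ≡.sym tyx
        ...     | inj₂ txy = ⊥-elim (true≢false (trans (≡.sym (compatible⇒downClosed compat Nx oyv txy)) x-out))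

    shape : o ≡ top ⊎ ∃[ x ] (N x ≡ true × o ≡ prefix x)
    shape with least-or-none (allFin n)
    ... | inj₁ none = inj₁ (none-out⇒top none)
    ... | inj₂ (x , least) = inj₂ (x , proj₁ (∧-true (proj₁ least)) , least-out⇒prefix least)

  prefix-arcs : ∀ {x y c} → prefix x ≡ prefix y → N c ≡ true → arc t c x ≡ arc t c y
  prefix-arcs {x} {y} {c} px≡py Nc =
    trans (≡.sym (star-in _ Nc)) (trans (cong (λ o → arc o c v) px≡py) (star-in _ Nc))

  prefix-injective : ∀ {x y} → N x ≡ true → N y ≡ true → prefix x ≡ prefix y → x ≡ y
  prefix-injective {x} {y} Nx Ny px≡py with x ≟ᶠ y
  ... | yes x≡y = x≡y
  ... | no x≢y with t-total (N⇒W Nx) (N⇒W Ny) x≢y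
  ...   | inj₁ txy = ⊥-elim (true≢false (trans (≡.sym txy)
                         (trans (≡.sym (prefix-arcs px≡py Nx)) (OT.arc-irrefl x))))
  ...   | inj₂ tyx = ⊥-elim (true≢false (trans (≡.sym tyx) (trans (prefix-arcs px≡py Ny) (OT.arc-irrefl y))))

  prefix≢top : ∀ {x} → N x ≡ true → prefix x ≢ top
  prefix≢top {x} Nx px≡top = true≢false (begin
    true               ≡⟨ ≡.sym (star-in _ Nx) ⟩
    arc top x v        ≡⟨ cong (λ o → arc o x v) (≡.sym px≡top) ⟩
    arc (prefix x) x v ≡⟨ star-in _ Nx ⟩
    arc t x x          ≡⟨ OT.arc-irrefl x ⟩
    false              ∎)
    where open ≡-Reasoning

  Valid : Orient n → Bool
  Valid o = (isOrientationOf S o ∧ K3free o) ∧ compatible o t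

  IsPrefix : Orient n → Bool
  IsPrefix o = any (λ x → N x ∧ does (o ≟ₒ prefix x)) (allFin n)

  IsShape : Orient n → Bool
  IsShape o = does (o ≟ₒ top) ∨ IsPrefix o

  star-valid : ∀ D → DownClosed D → Valid (star D) ≡ true
  star-valid D closed rewrite star-orients D | CrossOrientation.cross-K3free (star D) (star-orients D) =
    star-compatible D closed

  valid⇒shape : ∀ o → Valid o ≡ true → IsShape o ≡ true
  valid⇒shape o valid with ∧-true valid
  ... | orients-free , compat with ShapeOf.shape o (proj₁ (∧-true orients-free)) compat
  ...   | inj₁ o≡top = cong (_∨ IsPrefix o) (dec-true (o ≟ₒ top) o≡top)
  ...   | inj₂ (x , Nx , o≡px) = trans (cong (does (o ≟ₒ top) ∨_) isPrefix) (Bool.∨-zeroʳ _)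
    where isPrefix : IsPrefix o ≡ true
          isPrefix = any-intro _ (∈-allFin x) (cong₂ _∧_ Nx (dec-true (o ≟ₒ prefix x) o≡px))

  shape⇒valid : ∀ o → IsShape o ≡ true → Valid o ≡ true
  shape⇒valid o shape with ∨-true shape
  ... | inj₁ is-top rewrite does-true (o ≟ₒ top) is-top = star-valid (λ _ → true) (λ _ _ _ → refl)
  ... | inj₂ is-prefix with any-witness _ (allFin n) is-prefix
  ...   | x , _ , Nx∧o≡px rewrite does-true (o ≟ₒ prefix x) (proj₂ (∧-true Nx∧o≡px)) =
    star-valid (λ y → arc t y x) (λ _ tzx tyz → t-trans tyz tzx)

  top-not-prefix : ∀ o → does (o ≟ₒ top) ∧ IsPrefix o ≡ false
  top-not-prefix o with o ≟ₒ top
  ... | no _     = refl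
  ... | yes refl = any-none _ (allFin n) not-prefix
    where not-prefix : ∀ x → N x ∧ does (top ≟ₒ prefix x) ≡ false
          not-prefix x with N x in Nx
          ... | false = refl
          ... | true  = dec-false (top ≟ₒ prefix x) (λ top≡px → prefix≢top Nx (≡.sym top≡px))

  count-valid : count Valid (allOrients n) ≡ 1 + deg G v W
  count-valid = begin
    count Valid (allOrients n)
      ≡⟨ count-cong Valid IsShape (allOrients n) valid≡shape ⟩
    count (λ o → does (o ≟ₒ top) ∨ IsPrefix o) (allOrients n)
      ≡⟨ count-∨ _ IsPrefix (allOrients n) top-not-prefix ⟩
    count (λ o → does (o ≟ₒ top)) (allOrients n) + count IsPrefix (allOrients n)
      ≡⟨ cong₂ _+_ (enumerated top)
                   (count-image (allOrients n) enumerated prefix N prefix-injective (allFin n) (allFin⁺ n)) ⟩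
    1 + count N (allFin n) ∎
    where
      open ≡-Reasoning
      open Enumeration _≟ₒ_ using (count-image)
      enumerated = allOrients-enumerates n
      valid≡shape : ∀ o → Valid o ≡ IsShape o
      valid≡shape o = Bool.⇔→≡ (mk⇔ (valid⇒shape o) (shape⇒valid o))

  compatible-count : length (filterᵇ (λ s → compatible s t) (𝒟 S)) ≡ deg G v W + 1
  compatible-count = begin
    length (filterᵇ (λ s → compatible s t) (𝒟 S)) ≡⟨ cong length (filter-filter _ _ (allOrients n)) ⟩
    count Valid (allOrients n)                     ≡⟨ count-valid ⟩
    1 + deg G v W                                  ≡⟨ ℕ.+-comm 1 _ ⟩
    deg G v W + 1                                  ∎
    where open ≡-Reasoning

proposition2p3 : (n : ℕ) (G : Graph n) (v : Fin n) (W : Subset n) →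
    v ∉ W → IsCompleteOn G W →
    ext G ⁅ v ⁆ W ≡ deg G v W + 1
-- ext G {v} W is the maximum, over the K3-free orientations t of T, of the
-- number of orientations of G[{v},W] compatible with t.  That number is
-- d_G(v,W) + 1 for every such t, and T has one (orient edges by vertex index).
proposition2p3 n G v W v∉W complete =
  maxList-constant (λ t → length (filterᵇ (λ s → compatible s t) (𝒟 S))) (𝒟 T)
    (∈-𝒟⁺ {o = byIndex} byIndex-orients byIndex-K3free)
    (λ t∈ → let orients , free = ∈-𝒟⁻ t∈
            in CompleteStar.compatible-count G v W v∉W complete _ orients free)
  where
    open Star G v W v∉W using (S; T; T-sym; T-loopless)
    open ByIndex T T-sym T-loopless
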